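{- Let $q$ be an odd prime power with $q\equiv 1\pmod 3$, let $m=(q-1)/3$, and let $\gamma$ be a generator of the multiplicative group $\mathbf{F}_q^*$. For $k\in\{0,1,\dots,m-1\}$ define $a,b,c\in\mathbf{F}_q^*$ by $$a=\frac{2\gamma^{3k}}{3},\qquad b=\frac{1}{3},\qquad c=\frac{ -\gamma^{3k}}{3}.$$ Then the polynomial $$g(x)=ax^{3m-1}+bx^{2m+1}+cx^{2m-1}+bx^{m+1}+cx^{m-1}+bx$$ is a permutation polynomial over $\mathbf{F}_q$, and the permutation of $\mathbf{F}_q$ it induces is an involution with exactly $m+1$ fixed points.
   Context: $\mathbf{F}_q$ denotes the finite field with $q$ elements. A permutation polynomial over $\mathbf{F}_q$ is a polynomial $g\in\mathbf{F}_q[x]$ whose associated map $\mathbf{F}_q\to\mathbf{F}_q$, $x\mapsto g(x)$, is a bijection; it is involutory if $g(g(x))=x$ for all $x\in\mathbf{F}_q$. -}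

module Defs where

open import Level using (0ℓ)
open import Data.Nat as ℕ using (ℕ; zero; suc)
open import Data.Nat.Primality using (Prime)
open import Data.Fin using (Fin)
open import Data.Fin.Properties using () renaming (_≟_ to _≟ᶠ_)
open import Data.List using (List; length; filter)
open import Data.Fin.Base using ()
open import Data.List.Base using ()
open import Data.Product using (∃; _×_; _,_)
open import Function.Bundles using (_↔_; Inverse)
open import Relation.Nullary using (Dec; yes; no; ¬_)
open import Relation.Nullary.Decidable using (map′)
open import Relation.Binary.PropositionalEquality
open import Algebra.Structures using (IsCommutativeRing)
import Data.List.Base as L

IsPrimePower : ℕ → Set
IsPrimePower q = ∃ λ p → ∃ λ n → Prime p × q ≡ p ℕ.^ suc n

record FiniteField (q : ℕ) : Set₁ where
  infixl 6 _+_
  infixl 7 _*_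
  infixr 8 _^_
  field
    F      : Set
    _+_    : F → F → F
    _*_    : F → F → F
    -_     : F → F
    0# 1#  : F
    isCommutativeRing : IsCommutativeRing _≡_ _+_ _*_ -_ 0# 1#
    0≢1    : ¬ (0# ≡ 1#)
    invertible : ∀ x → ¬ (x ≡ 0#) → ∃ λ y → x * y ≡ 1#
    enum   : F ↔ Fin q

  _^_ : F → ℕ → F
  x ^ zero  = 1#
  x ^ suc n = x * (x ^ n)

  2# 3# : F
  2# = 1# + 1#
  3# = 1# + 1# + 1#

  IsGenerator : F → Set
  IsGenerator γ = ¬ (γ ≡ 0#) × (∀ x → ¬ (x ≡ 0#) → ∃ λ n → γ ^ n ≡ x)

  open Inverse enum using (to; from; strictlyInverseʳ)

  _≟_ : (x y : F) → Dec (x ≡ y)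
  x ≟ y = map′ (λ e → trans (sym (strictlyInverseʳ x)) (trans (cong from e) (strictlyInverseʳ y)))
               (cong to) (to x ≟ᶠ to y)

  numFixedPoints : (F → F) → ℕ
  numFixedPoints g = length (filter (λ i → g (from i) ≟ from i) (L.allFin q))

-- For x ≠ 0 put w = x ^ m and u = x ^ (m - 1); since F_q^* is cyclic of order 3m, w is a cube
-- root of unity and g x = a u w² + b x w² + c u w + b x w + c u + b x.  If w = 1 this is
-- (a + 2c) u + 3b x = x.  Otherwise 1 + w + w² = 0 and only (a - c) u w² = T x⁻¹ survives, where
-- T = γ ^ (3k).  Because T ^ m = 1, the map x ↦ T x⁻¹ preserves {x | x ^ m ≠ 1}, is an involution,
-- and has no fixed point there: T = x² would give w² = 1, hence w = w³ = 1.  So g is an involution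
-- fixing exactly 0 and the m elements γ ^ (3j), j < m.
module Submission where

open import Defs
open import Data.Nat
  using (ℕ; zero; suc; pred; _<_; _≤_; _∸_; _%_; _/_; z≤n; s≤s; z<s; NonZero; >-nonZero)
  renaming (_*_ to _*ℕ_; _+_ to _+ℕ_)
open import Data.Nat.Properties
  using (+-identityʳ; +-comm; *-suc; *-monoˡ-<; ≮⇒≥; ≤-antisym; ≤-refl; ≤-trans; <⇒≤; <⇒≱; ≤-<-trans;
         n<1+n; m∸n≤m; m<n⇒0<n∸m; m+[n∸m]≡n; suc-pred)
import Data.Nat.Properties as ℕ
open import Data.Nat.DivMod using (m≡m%n+[m/n]*n; m%n<n; m*n/n≡m)
open import Data.Fin using (Fin; toℕ; fromℕ<; punchIn; punchOut)
import Data.Fin as Fin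
open import Data.Fin.Properties
  using (pigeonhole; punchInᵢ≢i; punchIn-injective; punchOut-injective; toℕ≤pred[n]; toℕ-fromℕ<)
import Data.Fin.Properties as Finₚ
open import Data.Product using (_×_; ∃; _,_; proj₁; proj₂)
open import Data.Empty using (⊥-elim)
open import Data.List using (List; _∷_; applyDownFrom; allFin; filter; length)
open import Data.List.Properties using (filter-accept; filter-reject)
open import Data.List.Relation.Unary.Any using (here; there)
import Data.List.Relation.Unary.All as All
open import Data.List.Relation.Unary.AllPairs using (_∷_)
open import Data.List.Relation.Unary.Unique.Propositional using (Unique)
open import Data.List.Relation.Unary.Unique.Propositional.Properties using (applyDownFrom⁺₁; allFin⁺)
open import Data.List.Membership.Propositional using (_∈_)
open import Data.List.Membership.Propositional.Properties
  using (∈-applyDownFrom⁺; ∈-applyDownFrom⁻; ∈-allFin)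
open import Data.List.Membership.Propositional.Properties.WithK using (unique∧set⇒bag)
open import Data.List.Relation.Binary.BagAndSetEquality using (∼bag⇒↭)
open import Data.List.Relation.Binary.Permutation.Propositional using (_↭_)
open import Data.List.Relation.Binary.Permutation.Propositional.Properties using (↭-length; filter-↭)
open import Level using (0ℓ)
open import Algebra.Bundles using (CommutativeRing)
open import Function.Base using (_∘_)
open import Function.Bundles using (Inverse; mk⇔)
open import Function.Definitions using (Bijective)
open import Function.Consequences.Propositional
  using (inverseᵇ⇒bijective; strictlyInverseˡ⇒inverseˡ; strictlyInverseʳ⇒inverseʳ)
open import Relation.Unary using (Pred; Decidable)
open import Relation.Nullary using (¬_; yes; no; contradiction)
open import Relation.Binary.PropositionalEquality
  using (_≡_; _≢_; refl; sym; trans; cong; cong₂; subst; module ≡-Reasoning)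

module FieldProperties {q : ℕ} (K : FiniteField q) where
  open FiniteField K

  commutativeRing : CommutativeRing 0ℓ 0ℓ
  commutativeRing = record { isCommutativeRing = isCommutativeRing }

  open CommutativeRing commutativeRing public using (*-assoc; *-comm; *-identityˡ; *-identityʳ; zeroˡ; zeroʳ)
  open CommutativeRing commutativeRing using (-‿inverseʳ; +-group)
  open import Algebra.Properties.Group +-group using () renaming (∙-cancelʳ to +-cancelʳ)
  open import Algebra.Solver.Ring.NaturalCoefficients.Default
    (CommutativeRing.commutativeSemiring commutativeRing)

  ^-+ : ∀ x i j → x ^ (i +ℕ j) ≡ x ^ i * x ^ j
  ^-+ x zero    j = sym (*-identityˡ _)
  ^-+ x (suc i) j = trans (cong (x *_) (^-+ x i j)) (sym (*-assoc _ _ _))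

  ^-+1 : ∀ x i → x ^ (i +ℕ 1) ≡ x * x ^ i
  ^-+1 x i = cong (x ^_) (+-comm i 1)

  1^n≡1 : ∀ n → 1# ^ n ≡ 1#
  1^n≡1 zero    = refl
  1^n≡1 (suc n) = trans (*-identityˡ _) (1^n≡1 n)

  ^-distrib-* : ∀ x y n → (x * y) ^ n ≡ x ^ n * y ^ n
  ^-distrib-* x y zero    = sym (*-identityˡ _)
  ^-distrib-* x y (suc n) = trans (cong ((x * y) *_) (^-distrib-* x y n))
    (solve 4 (λ x y X Y → (x :* y) :* (X :* Y) := (x :* X) :* (y :* Y)) refl x y (x ^ n) (y ^ n))

  ^-* : ∀ x i j → x ^ (i *ℕ j) ≡ (x ^ i) ^ j
  ^-* x zero    j = sym (1^n≡1 j)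
  ^-* x (suc i) j = trans (^-+ x j (i *ℕ j))
    (trans (cong (x ^ j *_) (^-* x i j)) (sym (^-distrib-* x (x ^ i) j)))

  ^-*-comm : ∀ x i j → x ^ (i *ℕ j) ≡ (x ^ j) ^ i
  ^-*-comm x i j = trans (cong (x ^_) (ℕ.*-comm i j)) (^-* x j i)

  *-inverse-cancel : ∀ {x x′} → x * x′ ≡ 1# → ∀ y → x′ * (x * y) ≡ y
  *-inverse-cancel {x} {x′} xx′≡1 y = begin
    x′ * (x * y)  ≡⟨ solve 3 (λ x x′ y → x′ :* (x :* y) := (x :* x′) :* y) refl x x′ y ⟩
    x * x′ * y    ≡⟨ cong (_* y) xx′≡1 ⟩
    1# * y        ≡⟨ *-identityˡ y ⟩
    y             ∎
    where open ≡-Reasoning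

  *-cancelˡ : ∀ {x y z} → x ≢ 0# → x * y ≡ x * z → y ≡ z
  *-cancelˡ {x} {y} {z} x≢0 xy≡xz with x′ , xx′≡1 ← invertible x x≢0 =
    trans (sym (*-inverse-cancel xx′≡1 y)) (trans (cong (x′ *_) xy≡xz) (*-inverse-cancel xx′≡1 z))

  *-≢0 : ∀ {x y} → x ≢ 0# → y ≢ 0# → x * y ≢ 0#
  *-≢0 {x} x≢0 y≢0 xy≡0 = y≢0 (*-cancelˡ x≢0 (trans xy≡0 (sym (zeroʳ x))))

  ^-≢0 : ∀ {x} n → x ≢ 0# → x ^ n ≢ 0#
  ^-≢0 zero    x≢0 1≡0 = 0≢1 (sym 1≡0)
  ^-≢0 (suc n) x≢0     = *-≢0 x≢0 (^-≢0 n x≢0)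

  *-≡1⇒≢0 : ∀ {x y} → x * y ≡ 1# → x ≢ 0#
  *-≡1⇒≢0 {y = y} xy≡1 x≡0 = 0≢1 (trans (sym (zeroˡ y)) (trans (cong (_* y) (sym x≡0)) xy≡1))

  ^-cancel : ∀ {x i j} → x ≢ 0# → i ≤ j → x ^ i ≡ x ^ j → x ^ (j ∸ i) ≡ 1#
  ^-cancel {x} {i} {j} x≢0 i≤j xⁱ≡xʲ = sym (*-cancelˡ (^-≢0 i x≢0) (begin
    x ^ i * 1#               ≡⟨ *-identityʳ _ ⟩
    x ^ i                    ≡⟨ xⁱ≡xʲ ⟩
    x ^ j                    ≡⟨ cong (x ^_) (m+[n∸m]≡n i≤j) ⟨
    x ^ (i +ℕ (j ∸ i))       ≡⟨ ^-+ x i (j ∸ i) ⟩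
    x ^ i * x ^ (j ∸ i)      ∎))
    where open ≡-Reasoning

  ^-% : ∀ {x d} .{{_ : NonZero d}} → x ^ d ≡ 1# → ∀ n → x ^ n ≡ x ^ (n % d)
  ^-% {x} {d} xᵈ≡1 n = begin
    x ^ n                                ≡⟨ cong (x ^_) (m≡m%n+[m/n]*n n d) ⟩
    x ^ (n % d +ℕ n / d *ℕ d)            ≡⟨ ^-+ x (n % d) (n / d *ℕ d) ⟩
    x ^ (n % d) * x ^ (n / d *ℕ d)       ≡⟨ cong (x ^ (n % d) *_) (^-*-comm x (n / d) d) ⟩
    x ^ (n % d) * (x ^ d) ^ (n / d)      ≡⟨ cong (λ y → x ^ (n % d) * y ^ (n / d)) xᵈ≡1 ⟩
    x ^ (n % d) * 1# ^ (n / d)           ≡⟨ cong (x ^ (n % d) *_) (1^n≡1 (n / d)) ⟩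
    x ^ (n % d) * 1#                     ≡⟨ *-identityʳ _ ⟩
    x ^ (n % d)                          ∎
    where open ≡-Reasoning

  cube-root-of-unity : ∀ {w} → w ^ 3 ≡ 1# → w ≢ 1# → 1# + w + w * w ≡ 0#
  cube-root-of-unity {w} w³≡1 w≢1 with (1# + w + w * w) ≟ 0#
  ... | yes s≡0 = s≡0
  ... | no  s≢0 = contradiction (*-cancelˡ s≢0 (begin
    s * w               ≡⟨ solve 1 (λ w → (con 1 :+ w :+ w :* w) :* w := w :+ w :* w :+ w :* (w :* (w :* con 1))) refl w ⟩
    w + w * w + w ^ 3   ≡⟨ cong (w + w * w +_) w³≡1 ⟩
    w + w * w + 1#      ≡⟨ solve 1 (λ w → w :+ w :* w :+ con 1 := (con 1 :+ w :+ w :* w) :* con 1) refl w ⟩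
    s * 1#              ∎)) w≢1
    where
    open ≡-Reasoning
    s = 1# + w + w * w

  open Inverse enum public using (to; from; strictlyInverseˡ; strictlyInverseʳ)

  to-injective : ∀ {x y} → to x ≡ to y → x ≡ y
  to-injective {x} {y} tox≡toy =
    trans (sym (strictlyInverseʳ x)) (trans (cong from tox≡toy) (strictlyInverseʳ y))

  module PolynomialCoefficients (T inv3 : F) (3*inv3≡1 : 3# * inv3 ≡ 1#) where
    open ≡-Reasoning

    a b c : F
    a = 2# * T * inv3
    b = inv3
    c = (- T) * inv3

    G : F → F → F → F
    G x u w = a * (u * w ^ 2) + b * (x * w ^ 2) + c * (u * w) + b * (x * w) + c * u + b * x

    a+c+c≡0 : a + c + c ≡ 0#
    a+c+c≡0 = begin
      2# * T * inv3 + (- T) * inv3 + (- T) * inv3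
        ≡⟨ solve 3 (λ t t′ i → con 2 :* t :* i :+ t′ :* i :+ t′ :* i := (t :+ t′) :* (con 2 :* i)) refl T (- T) inv3 ⟩
      (T + - T) * (2# * inv3)  ≡⟨ cong (_* (2# * inv3)) (-‿inverseʳ T) ⟩
      0# * (2# * inv3)         ≡⟨ zeroˡ _ ⟩
      0#                       ∎

    T+c≡a : T + c ≡ a
    T+c≡a = begin
      T + (- T) * inv3                     ≡⟨ cong (_+ (- T) * inv3) (*-identityʳ T) ⟨
      T * 1# + (- T) * inv3                ≡⟨ cong (λ z → T * z + (- T) * inv3) 3*inv3≡1 ⟨
      T * (3# * inv3) + (- T) * inv3
        ≡⟨ solve 3 (λ t t′ i → t :* (con 3 :* i) :+ t′ :* i := con 2 :* t :* i :+ (t :+ t′) :* i) refl T (- T) inv3 ⟩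
      2# * T * inv3 + (T + - T) * inv3     ≡⟨ cong (λ z → 2# * T * inv3 + z * inv3) (-‿inverseʳ T) ⟩
      2# * T * inv3 + 0# * inv3            ≡⟨ solve 2 (λ t i → con 2 :* t :* i :+ con 0 :* i := con 2 :* t :* i) refl T inv3 ⟩
      2# * T * inv3                        ∎

    G-zero : ∀ w → G 0# 0# w ≡ 0#
    G-zero w = solve 4 (λ a c i w → a :* (con 0 :* (w :* (w :* con 1))) :+ i :* (con 0 :* (w :* (w :* con 1)))
                                     :+ c :* (con 0 :* w) :+ i :* (con 0 :* w) :+ c :* con 0 :+ i :* con 0 := con 0)
                       refl a c inv3 w

    G-unit : ∀ x u → G x u 1# ≡ x
    G-unit x u = begin
      G x u 1#
        ≡⟨ solve 5 (λ a b c x u → a :* (u :* (con 1 :* (con 1 :* con 1))) :+ b :* (x :* (con 1 :* (con 1 :* con 1)))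
                                   :+ c :* (u :* con 1) :+ b :* (x :* con 1) :+ c :* u :+ b :* x
                                 := (a :+ c :+ c) :* u :+ (con 3 :* b) :* x) refl a b c x u ⟩
      (a + c + c) * u + (3# * b) * x  ≡⟨ cong₂ (λ s t → s * u + t * x) a+c+c≡0 3*inv3≡1 ⟩
      0# * u + 1# * x                 ≡⟨ solve 2 (λ x u → con 0 :* u :+ con 1 :* x := x) refl x u ⟩
      x                               ∎

    G-root : ∀ x u {w} → 1# + w + w * w ≡ 0# → G x u w ≡ T * (u * w ^ 2)
    -- Adding c u w² to both sides makes the identity subtraction-free, so the semiring solver applies.
    G-root x u {w} s≡0 = +-cancelʳ (c * (u * w ^ 2)) _ _ (begin
      G x u w + c * (u * w ^ 2)
        ≡⟨ solve 6 (λ a b c x u w → a :* (u :* (w :* (w :* con 1))) :+ b :* (x :* (w :* (w :* con 1)))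
                                     :+ c :* (u :* w) :+ b :* (x :* w) :+ c :* u :+ b :* x :+ c :* (u :* (w :* (w :* con 1)))
                                   := a :* (u :* (w :* (w :* con 1))) :+ (con 1 :+ w :+ w :* w) :* (c :* u :+ b :* x))
                   refl a b c x u w ⟩
      a * (u * w ^ 2) + (1# + w + w * w) * (c * u + b * x)
        ≡⟨ cong₂ (λ α σ → α * (u * w ^ 2) + σ * (c * u + b * x)) (sym T+c≡a) s≡0 ⟩
      (T + c) * (u * w ^ 2) + 0# * (c * u + b * x)
        ≡⟨ solve 5 (λ t c x u w → (t :+ c) :* (u :* (w :* (w :* con 1))) :+ con 0 :* (c :* u :+ x)
                                 := t :* (u :* (w :* (w :* con 1))) :+ c :* (u :* (w :* (w :* con 1))))
                   refl T c (b * x) u w ⟩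
      T * (u * w ^ 2) + c * (u * w ^ 2)  ∎)

module MultiplicativeGroup {N : ℕ} (K : FiniteField (suc N)) where
  open FiniteField K
  open FieldProperties K

  nonzero : Fin N → F
  nonzero i = from (punchIn (to 0#) i)

  nonzero-≢0 : ∀ i → nonzero i ≢ 0#
  nonzero-≢0 i i≡0 = punchInᵢ≢i (to 0#) i (trans (sym (strictlyInverseˡ _)) (cong to i≡0))

  nonzero-injective : ∀ {i j} → nonzero i ≡ nonzero j → i ≡ j
  nonzero-injective {i} {j} eq = punchIn-injective (to 0#) i j
    (trans (sym (strictlyInverseˡ _)) (trans (cong to eq) (strictlyInverseˡ _)))

  period-exists : ∀ {x} → x ≢ 0# → ∃ λ e → 0 < e × e ≤ N × x ^ e ≡ 1#
  period-exists {x} x≢0 = collision⇒period (pigeonhole (n<1+n N) code)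
    where
    0≢power : ∀ i → to 0# ≢ to (x ^ toℕ i)
    0≢power i eq = ^-≢0 (toℕ i) x≢0 (sym (to-injective eq))

    code : Fin (suc N) → Fin N
    code i = punchOut (0≢power i)

    collision⇒period : (∃ λ i → ∃ λ j → i Fin.< j × code i ≡ code j) → ∃ λ e → 0 < e × e ≤ N × x ^ e ≡ 1#
    collision⇒period (i , j , i<j , codeᵢ≡codeⱼ) =
      toℕ j ∸ toℕ i , m<n⇒0<n∸m i<j , ≤-trans (m∸n≤m (toℕ j) (toℕ i)) (toℕ≤pred[n] j) ,
      ^-cancel x≢0 (<⇒≤ i<j) (to-injective (punchOut-injective (0≢power i) (0≢power j) codeᵢ≡codeⱼ))

  module Generator (γ : F) (γ-generates : IsGenerator γ) where

    γ≢0 : γ ≢ 0#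
    γ≢0 = proj₁ γ-generates

    log : ∀ {x} → x ≢ 0# → ∃ λ n → γ ^ n ≡ x
    log = proj₂ γ-generates _

    period-≥ : ∀ {d} → 0 < d → γ ^ d ≡ 1# → N ≤ d
    period-≥ {d} 0<d γᵈ≡1 = ≮⇒≥ λ d<N → no-collision (pigeonhole d<N exponent)
      where
      instance _ = >-nonZero 0<d

      exponent : Fin N → Fin d
      exponent i = fromℕ< (m%n<n (proj₁ (log (nonzero-≢0 i))) d)

      γ^exponent : ∀ i → γ ^ toℕ (exponent i) ≡ nonzero i
      γ^exponent i with n , γⁿ≡xᵢ ← log (nonzero-≢0 i) =
        trans (cong (γ ^_) (toℕ-fromℕ< (m%n<n n d))) (trans (sym (^-% γᵈ≡1 n)) γⁿ≡xᵢ)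

      no-collision : ¬ (∃ λ i → ∃ λ j → i Fin.< j × exponent i ≡ exponent j)
      no-collision (i , j , i<j , eq) = Finₚ.<⇒≢ i<j (nonzero-injective
        (trans (sym (γ^exponent i)) (trans (cong (λ e → γ ^ toℕ e) eq) (γ^exponent j))))

    period≡N : ∀ {e} → 0 < e → e ≤ N → γ ^ e ≡ 1# → e ≡ N
    period≡N 0<e e≤N γᵉ≡1 = ≤-antisym e≤N (period-≥ 0<e γᵉ≡1)

    γ^N≡1 : γ ^ N ≡ 1#
    γ^N≡1 = let e , 0<e , e≤N , γᵉ≡1 = period-exists γ≢0 in
      subst (λ e → γ ^ e ≡ 1#) (period≡N 0<e e≤N γᵉ≡1) γᵉ≡1

    instance
      N-nonZero : NonZero N
      N-nonZero = let e , 0<e , e≤N , _ = period-exists γ≢0 in >-nonZero (≤-trans 0<e e≤N)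

    γ^-injective : ∀ {i j} → j < i → i < N → γ ^ i ≢ γ ^ j
    γ^-injective {i} {j} j<i i<N γⁱ≡γʲ =
      <⇒≱ (≤-<-trans (m∸n≤m i j) i<N) (period-≥ (m<n⇒0<n∸m j<i) (^-cancel γ≢0 (<⇒≤ j<i) (sym γⁱ≡γʲ)))

    γ^≢1 : ∀ {i} → 0 < i → i < N → γ ^ i ≢ 1#
    γ^≢1 0<i i<N = γ^-injective 0<i i<N

    log< : ∀ {x} → x ≢ 0# → ∃ λ n → n < N × γ ^ n ≡ x
    log< x≢0 = let n , γⁿ≡x = log x≢0 in n % N , m%n<n n N , trans (sym (^-% γ^N≡1 n)) γⁿ≡x

    ^N≡1 : ∀ {x} → x ≢ 0# → x ^ N ≡ 1#
    ^N≡1 x≢0 with n , refl ← log x≢0 = begin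
      (γ ^ n) ^ N   ≡⟨ ^-*-comm γ N n ⟨
      γ ^ (N *ℕ n)  ≡⟨ ^-* γ N n ⟩
      (γ ^ N) ^ n   ≡⟨ cong (_^ n) γ^N≡1 ⟩
      1# ^ n        ≡⟨ 1^n≡1 n ⟩
      1#            ∎
      where open ≡-Reasoning

    ^N*≡1 : ∀ {x} → x ≢ 0# → ∀ j → x ^ (N *ℕ j) ≡ 1#
    ^N*≡1 {x} x≢0 j = trans (^-* x N j) (trans (cong (_^ j) (^N≡1 x≢0)) (1^n≡1 j))

    infix 9 _⁻¹
    _⁻¹ : F → F
    x ⁻¹ = x ^ pred N

    ⁻¹-inverseʳ : ∀ {x} → x ≢ 0# → x * x ⁻¹ ≡ 1#
    ⁻¹-inverseʳ {x} x≢0 = trans (cong (x ^_) (suc-pred N)) (^N≡1 x≢0)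

    ⁻¹-inverseˡ : ∀ {x} → x ≢ 0# → x ⁻¹ * x ≡ 1#
    ⁻¹-inverseˡ {x} x≢0 = trans (*-comm _ x) (⁻¹-inverseʳ x≢0)

    ⁻¹-unique : ∀ {x y} → x * y ≡ 1# → x ⁻¹ ≡ y
    ⁻¹-unique xy≡1 = *-cancelˡ x≢0 (trans (⁻¹-inverseʳ x≢0) (sym xy≡1))
      where x≢0 = *-≡1⇒≢0 xy≡1

    ⁻¹-involutive : ∀ {x} → x ≢ 0# → x ⁻¹ ⁻¹ ≡ x
    ⁻¹-involutive x≢0 = ⁻¹-unique (⁻¹-inverseˡ x≢0)

    ⁻¹-distrib-* : ∀ x y → (x * y) ⁻¹ ≡ x ⁻¹ * y ⁻¹
    ⁻¹-distrib-* x y = ^-distrib-* x y (pred N)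

    ^-⁻¹ : ∀ x n → (x ^ n) ⁻¹ ≡ (x ⁻¹) ^ n
    ^-⁻¹ x n = trans (sym (^-* x n (pred N))) (^-*-comm x n (pred N))

    ⁻¹≡1⇒≡1 : ∀ {x} → x ≢ 0# → x ⁻¹ ≡ 1# → x ≡ 1#
    ⁻¹≡1⇒≡1 {x} x≢0 x⁻¹≡1 = trans (sym (*-identityʳ x)) (trans (cong (x *_) (sym x⁻¹≡1)) (⁻¹-inverseʳ x≢0))

    powerCodes : List (Fin (suc N))
    powerCodes = to 0# ∷ applyDownFrom (λ i → to (γ ^ i)) N

    powerCodes-unique : Unique powerCodes
    powerCodes-unique = All.tabulate 0∉powers ∷ applyDownFrom⁺₁ _ N (λ j<i i<N → γ^-injective j<i i<N ∘ to-injective)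
      where
      0∉powers : ∀ {c} → c ∈ applyDownFrom (λ i → to (γ ^ i)) N → to 0# ≢ c
      0∉powers c∈ with i , _ , refl ← ∈-applyDownFrom⁻ _ c∈ = ^-≢0 i γ≢0 ∘ sym ∘ to-injective

    to-∈-powerCodes : ∀ x → to x ∈ powerCodes
    to-∈-powerCodes x with x ≟ 0#
    ... | yes refl = here refl
    ... | no  x≢0  = let n , n<N , γⁿ≡x = log< x≢0 in
      there (subst (λ y → to y ∈ _) γⁿ≡x (∈-applyDownFrom⁺ _ n<N))

    ∈-powerCodes : ∀ c → c ∈ powerCodes
    ∈-powerCodes c = subst (_∈ powerCodes) (strictlyInverseˡ c) (to-∈-powerCodes (from c))

    allFin↭powerCodes : allFin (suc N) ↭ powerCodes
    allFin↭powerCodes = ∼bag⇒↭ (unique∧set⇒bag (allFin⁺ (suc N)) powerCodes-unique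
      (mk⇔ (λ _ → ∈-powerCodes _) (λ _ → ∈-allFin _)))

    numFixedPoints-powerCodes : ∀ h → numFixedPoints h ≡ length (filter (λ c → h (from c) ≟ from c) powerCodes)
    numFixedPoints-powerCodes h = ↭-length (filter-↭ (λ c → h (from c) ≟ from c) allFin↭powerCodes)

length-filter-every-third : ∀ {a p} {A : Set a} {P : Pred A p} (P? : Decidable P) (f : ℕ → A) →
  (∀ j → P (f (3 *ℕ j))) → (∀ j → ¬ P (f (1 +ℕ 3 *ℕ j))) → (∀ j → ¬ P (f (2 +ℕ 3 *ℕ j))) →
  ∀ m → length (filter P? (applyDownFrom f (3 *ℕ m))) ≡ m
length-filter-every-third P? f P₀ ¬P₁ ¬P₂ zero = refl
length-filter-every-third P? f P₀ ¬P₁ ¬P₂ (suc m) = begin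
  length (filter P? (applyDownFrom f (3 *ℕ suc m)))
    ≡⟨ cong (length ∘ filter P? ∘ applyDownFrom f) (*-suc 3 m) ⟩
  length (filter P? (f (2 +ℕ 3 *ℕ m) ∷ f (1 +ℕ 3 *ℕ m) ∷ f (3 *ℕ m) ∷ rest))
    ≡⟨ cong length (filter-reject P? (¬P₂ m)) ⟩
  length (filter P? (f (1 +ℕ 3 *ℕ m) ∷ f (3 *ℕ m) ∷ rest))
    ≡⟨ cong length (filter-reject P? (¬P₁ m)) ⟩
  length (filter P? (f (3 *ℕ m) ∷ rest))
    ≡⟨ cong length (filter-accept P? (P₀ m)) ⟩
  suc (length (filter P? rest))
    ≡⟨ cong suc (length-filter-every-third P? f P₀ ¬P₁ ¬P₂ m) ⟩
  suc m ∎
  where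
  open ≡-Reasoning
  rest = applyDownFrom f (3 *ℕ m)

involutive⇒bijective : ∀ {a} {A : Set a} {f : A → A} → (∀ x → f (f x) ≡ x) → Bijective _≡_ _≡_ f
involutive⇒bijective {f = f} f∘f≡id =
  inverseᵇ⇒bijective (strictlyInverseˡ⇒inverseˡ f f∘f≡id , strictlyInverseʳ⇒inverseʳ f f∘f≡id)

module Involution (n : ℕ) (K : FiniteField (suc (3 *ℕ (2 +ℕ n)))) where
  open FiniteField K
  open FieldProperties K

  m : ℕ
  m = 2 +ℕ n

  ^[3m∸1] : ∀ x → x ^ (3 *ℕ m ∸ 1) ≡ x ^ suc n * (x ^ m) ^ 2
  ^[3m∸1] x = trans (^-+ x (suc n) (2 *ℕ m)) (cong (x ^ suc n *_) (^-*-comm x 2 m))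

  ^[2m∸1] : ∀ x → x ^ (2 *ℕ m ∸ 1) ≡ x ^ suc n * x ^ m
  ^[2m∸1] x = trans (cong (λ e → x ^ (suc n +ℕ e)) (+-identityʳ m)) (^-+ x (suc n) m)

  ^[2m+1] : ∀ x → x ^ (2 *ℕ m +ℕ 1) ≡ x * (x ^ m) ^ 2
  ^[2m+1] x = trans (^-+1 x (2 *ℕ m)) (cong (x *_) (^-*-comm x 2 m))

  module Polynomial (γ : F) (γ-generates : IsGenerator γ) (inv3 : F) (3*inv3≡1 : 3# * inv3 ≡ 1#) (k : ℕ) where
    T : F
    T = γ ^ (3 *ℕ k)

    open MultiplicativeGroup K
    open Generator γ γ-generates
    open PolynomialCoefficients T inv3 3*inv3≡1
    open ≡-Reasoning

    g : F → F
    g x = a * x ^ (3 *ℕ m ∸ 1) + b * x ^ (2 *ℕ m +ℕ 1) + c * x ^ (2 *ℕ m ∸ 1)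
          + b * x ^ (m +ℕ 1) + c * x ^ (m ∸ 1) + b * x

    g≡G : ∀ x → g x ≡ G x (x ^ suc n) (x ^ m)
    g≡G x = monomials (^[3m∸1] x) (^[2m+1] x) (^[2m∸1] x) (^-+1 x m)
      where
      monomials : ∀ {p₁ p₂ p₃ p₄ q₁ q₂ q₃ q₄} → p₁ ≡ q₁ → p₂ ≡ q₂ → p₃ ≡ q₃ → p₄ ≡ q₄ →
        a * p₁ + b * p₂ + c * p₃ + b * p₄ + c * x ^ suc n + b * x ≡
        a * q₁ + b * q₂ + c * q₃ + b * q₄ + c * x ^ suc n + b * x
      monomials refl refl refl refl = refl

    g-zero : g 0# ≡ 0#
    g-zero = trans (g≡G 0#) (trans (cong (λ u → G 0# u (0# ^ m)) (zeroˡ _)) (G-zero _))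

    ^m-cubed : ∀ {x} → x ≢ 0# → (x ^ m) ^ 3 ≡ 1#
    ^m-cubed {x} x≢0 = trans (sym (^-*-comm x 3 m)) (^N≡1 x≢0)

    ^[3j]^m≡1 : ∀ {x} → x ≢ 0# → ∀ j → (x ^ (3 *ℕ j)) ^ m ≡ 1#
    ^[3j]^m≡1 {x} x≢0 j = begin
      (x ^ (3 *ℕ j)) ^ m      ≡⟨ ^-* x (3 *ℕ j) m ⟨
      x ^ (3 *ℕ j *ℕ m)       ≡⟨ cong (x ^_) (trans (ℕ.*-assoc 3 j m) (trans (cong (3 *ℕ_) (ℕ.*-comm j m)) (sym (ℕ.*-assoc 3 m j)))) ⟩
      x ^ (3 *ℕ m *ℕ j)       ≡⟨ ^N*≡1 x≢0 j ⟩
      1#                      ∎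

    T≢0 : T ≢ 0#
    T≢0 = ^-≢0 (3 *ℕ k) γ≢0

    g-root : ∀ {x} → x ^ m ≡ 1# → g x ≡ x
    g-root {x} xᵐ≡1 = trans (g≡G x) (trans (cong (G x _) xᵐ≡1) (G-unit x _))

    g-nonroot : ∀ {x} → x ≢ 0# → x ^ m ≢ 1# → g x ≡ T * x ⁻¹
    g-nonroot {x} x≢0 xᵐ≢1 = begin
      g x                           ≡⟨ g≡G x ⟩
      G x (x ^ suc n) (x ^ m)       ≡⟨ G-root x _ (cube-root-of-unity (^m-cubed x≢0) xᵐ≢1) ⟩
      T * (x ^ suc n * (x ^ m) ^ 2) ≡⟨ cong (T *_) (^[3m∸1] x) ⟨
      T * x ⁻¹                      ∎

    g-swaps : ∀ {x} → x ≢ 0# → x ^ m ≢ 1# → g (g x) ≡ x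
    g-swaps {x} x≢0 xᵐ≢1 = begin
      g (g x)               ≡⟨ cong g (g-nonroot x≢0 xᵐ≢1) ⟩
      g (T * x ⁻¹)          ≡⟨ g-nonroot (*-≢0 T≢0 (^-≢0 (pred (3 *ℕ m)) x≢0)) yᵐ≢1 ⟩
      T * (T * x ⁻¹) ⁻¹     ≡⟨ cong (T *_) (⁻¹-distrib-* T (x ⁻¹)) ⟩
      T * (T ⁻¹ * x ⁻¹ ⁻¹)  ≡⟨ cong (λ z → T * (T ⁻¹ * z)) (⁻¹-involutive x≢0) ⟩
      T * (T ⁻¹ * x)        ≡⟨ *-inverse-cancel (⁻¹-inverseˡ T≢0) x ⟩
      x                     ∎
      where
      yᵐ≢1 : (T * x ⁻¹) ^ m ≢ 1#
      yᵐ≢1 yᵐ≡1 = xᵐ≢1 (⁻¹≡1⇒≡1 (^-≢0 m x≢0) (begin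
        (x ^ m) ⁻¹           ≡⟨ ^-⁻¹ x m ⟩
        x ⁻¹ ^ m             ≡⟨ *-identityˡ _ ⟨
        1# * x ⁻¹ ^ m        ≡⟨ cong (_* x ⁻¹ ^ m) (^[3j]^m≡1 γ≢0 k) ⟨
        T ^ m * x ⁻¹ ^ m     ≡⟨ ^-distrib-* T (x ⁻¹) m ⟨
        (T * x ⁻¹) ^ m       ≡⟨ yᵐ≡1 ⟩
        1#                   ∎))

    g-involutive : ∀ x → g (g x) ≡ x
    g-involutive x with x ≟ 0# | (x ^ m) ≟ 1#
    ... | yes refl | _         = trans (cong g g-zero) g-zero
    ... | no _     | yes xᵐ≡1  = trans (cong g (g-root xᵐ≡1)) (g-root xᵐ≡1)
    ... | no x≢0   | no xᵐ≢1   = g-swaps x≢0 xᵐ≢1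

    g-fixed⇒root : ∀ {x} → x ≢ 0# → g x ≡ x → x ^ m ≡ 1#
    g-fixed⇒root {x} x≢0 gx≡x with (x ^ m) ≟ 1#
    ... | yes xᵐ≡1 = xᵐ≡1
    ... | no  xᵐ≢1 = contradiction (begin
      w              ≡⟨ *-identityʳ w ⟨
      w * 1#         ≡⟨ cong (w *_) w²≡1 ⟨
      w * (w * w)    ≡⟨ cong (λ z → w * (w * z)) (*-identityʳ w) ⟨
      w ^ 3          ≡⟨ ^m-cubed x≢0 ⟩
      1#             ∎) xᵐ≢1
      where
      w = x ^ m

      T≡x² : T ≡ x * x
      T≡x² = begin
        T                ≡⟨ *-identityʳ T ⟨
        T * 1#           ≡⟨ cong (T *_) (⁻¹-inverseˡ x≢0) ⟨
        T * (x ⁻¹ * x)   ≡⟨ *-assoc T (x ⁻¹) x ⟨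
        T * x ⁻¹ * x     ≡⟨ cong (_* x) (trans (sym (g-nonroot x≢0 xᵐ≢1)) gx≡x) ⟩
        x * x            ∎

      w²≡1 : w * w ≡ 1#
      w²≡1 = trans (sym (^-distrib-* x x m)) (trans (cong (_^ m) (sym T≡x²)) (^[3j]^m≡1 γ≢0 k))

    ^m-of-power : ∀ r j → (γ ^ (r +ℕ 3 *ℕ j)) ^ m ≡ γ ^ (r *ℕ m)
    ^m-of-power r j = begin
      (γ ^ (r +ℕ 3 *ℕ j)) ^ m             ≡⟨ cong (_^ m) (^-+ γ r (3 *ℕ j)) ⟩
      (γ ^ r * γ ^ (3 *ℕ j)) ^ m          ≡⟨ ^-distrib-* (γ ^ r) (γ ^ (3 *ℕ j)) m ⟩
      (γ ^ r) ^ m * (γ ^ (3 *ℕ j)) ^ m    ≡⟨ cong₂ _*_ (^-* γ r m) (sym (^[3j]^m≡1 γ≢0 j)) ⟨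
      γ ^ (r *ℕ m) * 1#                    ≡⟨ *-identityʳ _ ⟩
      γ ^ (r *ℕ m)                         ∎

    power-fixed : ∀ j → g (γ ^ (3 *ℕ j)) ≡ γ ^ (3 *ℕ j)
    power-fixed j = g-root (^[3j]^m≡1 γ≢0 j)

    power-moved : ∀ {r} → 0 < r → r < 3 → ∀ j → g (γ ^ (r +ℕ 3 *ℕ j)) ≢ γ ^ (r +ℕ 3 *ℕ j)
    power-moved {r} 0<r r<3 j fixed = γ^≢1 (*-monoˡ-< m 0<r) (*-monoˡ-< m r<3)
      (trans (sym (^m-of-power r j)) (g-fixed⇒root (^-≢0 (r +ℕ 3 *ℕ j) γ≢0) fixed))

    Fixed : Fin (suc (3 *ℕ m)) → Set
    Fixed c = g (from c) ≡ from c

    fixed-code : ∀ {x} → g x ≡ x → Fixed (to x)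
    fixed-code {x} = subst (λ z → g z ≡ z) (sym (strictlyInverseʳ x))

    moved-code : ∀ {x} → g x ≢ x → ¬ Fixed (to x)
    moved-code {x} gx≢x = gx≢x ∘ subst (λ z → g z ≡ z) (strictlyInverseʳ x)

    numFixedPoints-g : numFixedPoints g ≡ suc m
    numFixedPoints-g = begin
      numFixedPoints g
        ≡⟨ numFixedPoints-powerCodes g ⟩
      length (filter Fixed? powerCodes)
        ≡⟨ cong length (filter-accept Fixed? (fixed-code g-zero)) ⟩
      suc (length (filter Fixed? (applyDownFrom (λ i → to (γ ^ i)) (3 *ℕ m))))
        ≡⟨ cong suc (length-filter-every-third Fixed? _ (fixed-code ∘ power-fixed)
                      (moved-code ∘ power-moved z<s (s≤s (s≤s z≤n))) (moved-code ∘ power-moved z<s ≤-refl) m) ⟩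
      suc m ∎
      where
      Fixed? : Decidable Fixed
      Fixed? c = g (from c) ≟ from c

q≡1+3[[q∸1]/3] : ∀ {q} → q % 3 ≡ 1 → q ≡ suc (3 *ℕ ((q ∸ 1) / 3))
q≡1+3[[q∸1]/3] {q} q%3≡1 = begin
  q                                  ≡⟨ q≡1+[q/3]*3 ⟩
  suc (q / 3 *ℕ 3)                   ≡⟨ cong suc (ℕ.*-comm (q / 3) 3) ⟩
  suc (3 *ℕ (q / 3))                 ≡⟨ cong (λ z → suc (3 *ℕ z)) (m*n/n≡m (q / 3) 3) ⟨
  suc (3 *ℕ (q / 3 *ℕ 3 / 3))        ≡⟨ cong (λ z → suc (3 *ℕ ((z ∸ 1) / 3))) q≡1+[q/3]*3 ⟨
  suc (3 *ℕ ((q ∸ 1) / 3))           ∎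
  where
  open ≡-Reasoning
  q≡1+[q/3]*3 : q ≡ suc (q / 3 *ℕ 3)
  q≡1+[q/3]*3 = trans (m≡m%n+[m/n]*n q 3) (cong (_+ℕ q / 3 *ℕ 3) q%3≡1)

no-field-of-size-1 : ¬ FiniteField 1
no-field-of-size-1 K = 0≢1 (to-injective (trans (Fin1-unique (to 0#)) (sym (Fin1-unique (to 1#)))))
  where
  open FiniteField K
  open FieldProperties K
  Fin1-unique : (i : Fin 1) → i ≡ Fin.zero
  Fin1-unique Fin.zero = refl

theorem2p4 : (q : ℕ) → IsPrimePower q → q % 2 ≡ 1 → q % 3 ≡ 1 →
    (K : FiniteField q) → let open FiniteField K in
    (γ : F) → IsGenerator γ →
    (inv3 : F) → 3# * inv3 ≡ 1# →
    (k : ℕ) → k < (q ∸ 1) / 3 →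
    let m = (q ∸ 1) / 3
        a = 2# * γ ^ (3 *ℕ k) * inv3
        b = inv3
        c = (- (γ ^ (3 *ℕ k))) * inv3
        g = λ x → a * x ^ (3 *ℕ m ∸ 1) + b * x ^ (2 *ℕ m +ℕ 1)
                  + c * x ^ (2 *ℕ m ∸ 1) + b * x ^ (m +ℕ 1)
                  + c * x ^ (m ∸ 1) + b * x
    in Bijective _≡_ _≡_ g × (∀ x → g (g x) ≡ x) × numFixedPoints g ≡ suc m
theorem2p4 q _ q-odd q%3≡1 K γ γ-generates inv3 3*inv3≡1 k _ with (q ∸ 1) / 3 | q≡1+3[[q∸1]/3] {q} q%3≡1
... | zero        | refl = ⊥-elim (no-field-of-size-1 K)
-- q = 4 must be excluded: for m = 1 the monomial c x^(m-1) is the constant c, so g 0 ≠ 0.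
theorem2p4 _ _ () _ _ _ _ _ _ _ _ | suc zero | refl
... | suc (suc n) | refl = involutive⇒bijective g-involutive , g-involutive , numFixedPoints-g
  where open Involution.Polynomial n K γ γ-generates inv3 3*inv3≡1 k
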